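{- Let $n\ge 0$ and let $i\ge j\ge 0$ be integers with $i+j\le n$ and $i+j\equiv n\pmod 2$. Let $$\mathcal{M}^{(2)}_{n,i;j}=\{(P,Q): P,Q \text{ paths of length } n,\ -P\le Q\le P,\ h(P)=i+j,\ h(Q)=i-j\},$$ $$\mathcal{P}^{(2)}_{n,i;j}=\{(P,Q): P,Q \text{ paths of length } n,\ 0\le Q\le P,\ i-j\le h(Q)\le i+j\le h(P)\}.$$ Then the map $\varphi:\mathcal{M}^{(2)}_{n,i;j}\to\mathcal{P}^{(2)}_{n,i;j}$ defined in the context is surjective.
   Context: A path of length $n$ is a lattice path in $\mathbb{Z}^2$ starting at $(0,0)$ with $n$ steps, each $U=(1,1)$ or $D=(1,-1)$. $h_a(P)$ is the $y$-coordinate at $x=a$, $h(P)=h_n(P)$; $Q\le P$ means $h_a(Q)\le h_a(P)$ for all $a$; $0\le Q$ means $h_a(Q)\ge0$ for all $a$; $-P$ is the reflection of $P$ in the $x$-axis. Flipping a step means changing $U$ to $D$ or vice versa. The disagreement path $(P-Q)/2$ is the path with steps $U,D,H=(1,0)$ whose height at each $a$ is $(h_a(P)-h_a(Q))/2$. Matching: ignoring $H$ steps and reading left to right, regard $U$ as "(" and $D$ as ")", and match each $D$ with the nearest preceding not-yet-matched $U$, if any; the remaining $U$ and $D$ steps are unmatched. The map $\varphi$: given $(P,Q)$, let $Q'$ be obtained from $Q$ by flipping every step ending strictly below the $x$-axis; let $\chi$ be the set of positions of the unmatched $D$ steps of $(P-Q')/2$; let $\widetilde P,\widetilde Q$ be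 obtained from $P,Q'$ by flipping the steps in positions $\chi$; set $\varphi(P,Q)=(\widetilde P,\widetilde Q)$. (It is known that $\varphi$ maps $\mathcal{M}^{(2)}_{n,i;j}$ into $\mathcal{P}^{(2)}_{n,i;j}$.) -}

module Defs where

open import Data.Bool using (Bool; true; false; not; if_then_else_; _xor_)
open import Data.Nat using (ℕ; zero; suc)
open import Data.Integer using (ℤ; +_; -[1+_]; _+_; _-_; -_; _≤_)
open import Data.Fin using (Fin)
open import Data.Vec using (Vec; []; _∷_; map; lookup; zipWith)
open import Data.Product using (_×_; _,_)
open import Relation.Binary.PropositionalEquality using (_≡_)

-- A path of length n: a vector of steps; true = U = (1,1), false = D = (1,-1).
Path : ℕ → Set
Path n = Vec Bool n

stepVal : Bool → ℤ
stepVal true  = + 1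
stepVal false = -[1+ 0 ]

heights : ∀ {n} → Path n → Vec ℤ (suc n)
heights []       = + 0 ∷ []
heights (b ∷ bs) = + 0 ∷ map (λ x → stepVal b + x) (heights bs)

ht : ∀ {n} → Fin (suc n) → Path n → ℤ
ht a P = lookup (heights P) a

hEnd : ∀ {n} → Path n → ℤ
hEnd []       = + 0
hEnd (b ∷ bs) = stepVal b + hEnd bs

_≤ₚ_ : ∀ {n} → Path n → Path n → Set
Q ≤ₚ P = ∀ a → ht a Q ≤ ht a P

NonNeg : ∀ {n} → Path n → Set
NonNeg Q = ∀ a → + 0 ≤ ht a Q

negP : ∀ {n} → Path n → Path n
negP = map not

isNeg : ℤ → Bool
isNeg (+ _)    = false
isNeg -[1+ _ ] = true

-- flip every step ending strictly below the x-axis; the argument c is the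
-- current height (of the original path) before the step.
flipBelowFrom : ∀ {n} → ℤ → Path n → Path n
flipBelowFrom c []       = []
flipBelowFrom c (b ∷ bs) =
  (if isNeg (c + stepVal b) then not b else b) ∷ flipBelowFrom (c + stepVal b) bs

flipBelow : ∀ {n} → Path n → Path n
flipBelow = flipBelowFrom (+ 0)

-- Unmatched D steps of the disagreement path (P - Q)/2, as a mask.
-- Step k of (P-Q)/2 is U iff P_k = U, Q_k = D; D iff P_k = D, Q_k = U; H otherwise.
-- k = number of currently unmatched U steps seen so far.
unmatchedDFrom : ∀ {n} → ℕ → Path n → Path n → Vec Bool n
unmatchedDFrom k       []          []          = []
unmatchedDFrom k       (true ∷ ps)  (false ∷ qs) = false ∷ unmatchedDFrom (suc k) ps qs
unmatchedDFrom zero    (false ∷ ps) (true ∷ qs)  = true ∷ unmatchedDFrom zero ps qs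
unmatchedDFrom (suc k) (false ∷ ps) (true ∷ qs)  = false ∷ unmatchedDFrom k ps qs
unmatchedDFrom k       (true ∷ ps)  (true ∷ qs)  = false ∷ unmatchedDFrom k ps qs
unmatchedDFrom k       (false ∷ ps) (false ∷ qs) = false ∷ unmatchedDFrom k ps qs

unmatchedD : ∀ {n} → Path n → Path n → Vec Bool n
unmatchedD = unmatchedDFrom 0

flipAt : ∀ {n} → Vec Bool n → Path n → Path n
flipAt χ P = zipWith _xor_ P χ

φ : ∀ {n} → Path n → Path n → Path n × Path n
φ P Q = let Q' = flipBelow Q
            χ  = unmatchedD P Q'
        in flipAt χ P , flipAt χ Q'

InM : (n i j : ℕ) → Path n → Path n → Set
InM n i j P Q = (negP P ≤ₚ Q) × (Q ≤ₚ P) × (hEnd P ≡ + (i Data.Nat.+ j)) × (hEnd Q ≡ + i - + j)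

InP : (n i j : ℕ) → Path n → Path n → Set
InP n i j P Q = NonNeg Q × (Q ≤ₚ P) × (+ i - + j ≤ hEnd Q)
              × (hEnd Q ≤ + (i Data.Nat.+ j)) × (+ (i Data.Nat.+ j) ≤ hEnd P)

-- φ is undone in two steps.  Since Q' ≤ P', the disagreement path (P' - Q')/2 is
-- nonnegative and ends at height (h(P') - h(Q'))/2 ≥ K, where h(P') = i + j + 2K.
-- Turning its first K unmatched U steps back into D steps gives a pair (P, Q₁) with
-- h(P) = i + j whose unmatched D steps are exactly those K steps, so flipping them
-- returns (P', Q').  Then Q' ≤ Q₁ stepwise, so Q₁ ≥ 0 and h(Q₁) = h(Q') + 2K = i - j + 2M
-- with M = r + K, where h(Q') = i - j + 2r.  A path Q with flipBelow Q = Q₁ is obtained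
-- by letting Q leave the axis downwards, and later return, at last visits of Q₁ to a
-- level; each such excursion makes h(Q) two less than h(Q₁), and taking the first M of
-- them gives h(Q) = i - j.  Since Q₁ exceeds Q' only by the K raised steps, this greedy
-- choice keeps -Q' ≤ Q ≤ Q' ≤ P, hence -P ≤ Q ≤ P.

module Submission where

open import Defs
open import Data.Bool using (Bool; true; false; not; if_then_else_)
open import Data.Nat using (ℕ; zero; suc; pred; _+_; _*_; _∸_; _≤_; _%_; _/_; z≤n; s≤s)
import Data.Nat.Properties as ℕ
open import Algebra.Properties.CommutativeSemigroup ℕ.+-commutativeSemigroup using (x∙yz≈xz∙y)
open import Data.Nat.DivMod using (m≡m%n+[m/n]*n; /-monoˡ-≤; [m+kn]%n≡m%n)
open import Data.Integer using (ℤ; +_; -[1+_]; +≤+)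
import Data.Integer as ℤ hiding (+_)
import Data.Integer.Properties as ℤ
open import Algebra.Properties.AbelianGroup ℤ.+-0-abelianGroup using () renaming (∙-cancelʳ to +ℤ-cancelʳ)
open import Data.Fin using (Fin)
import Data.Fin as Fin
open import Data.Vec using ([]; _∷_)
open import Data.Vec.Properties using (lookup-map)
open import Data.Product using (Σ; ∃; _×_; _,_; proj₁; proj₂; uncurry)
open import Data.Sum using (_⊎_; inj₁; inj₂)
open import Relation.Binary.PropositionalEquality
open import Relation.Nullary using (¬_)
open import Data.Empty using (⊥-elim)
import Data.Nat.Tactic.RingSolver as ℕ-Solver
import Data.Integer.Tactic.RingSolver as ℤ-Solver

downs : ∀ {n} → Path n → ℕ
downs []          = 0
downs (true ∷ X)  = downs X
downs (false ∷ X) = suc (downs X)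

downs+downs-negP : ∀ {n} (X : Path n) → downs X + downs (negP X) ≡ n
downs+downs-negP []          = refl
downs+downs-negP (true ∷ X)  = trans (ℕ.+-suc (downs X) _) (cong suc (downs+downs-negP X))
downs+downs-negP (false ∷ X) = cong suc (downs+downs-negP X)

m+n*2≡m+n+n : ∀ m n → m + n * 2 ≡ m + n + n
m+n*2≡m+n+n = ℕ-Solver.solve-∀

hEnd+downs*2 : ∀ {n} (X : Path n) → hEnd X ℤ.+ + (downs X * 2) ≡ + n
hEnd+downs*2 []          = refl
hEnd+downs*2 (true ∷ X)  = trans (ℤ.+-assoc (+ 1) (hEnd X) _) (cong ℤ.suc (hEnd+downs*2 X))
hEnd+downs*2 (false ∷ X) = trans (regroup (hEnd X) (+ (downs X * 2))) (cong ℤ.suc (hEnd+downs*2 X))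
  where
  regroup : ∀ h e → (-[1+ 0 ] ℤ.+ h) ℤ.+ (+ 2 ℤ.+ e) ≡ + 1 ℤ.+ (h ℤ.+ e)
  regroup = ℤ-Solver.solve-∀

+m≤hEnd⇒m+downs*2≤n : ∀ {n m} (X : Path n) → + m ℤ.≤ hEnd X → m + downs X * 2 ≤ n
+m≤hEnd⇒m+downs*2≤n {m = m} X m≤h = ℤ.drop‿+≤+
  (subst₂ ℤ._≤_ (sym (ℤ.pos-+ m (downs X * 2))) (hEnd+downs*2 X) (ℤ.+-monoˡ-≤ (+ (downs X * 2)) m≤h))

hEnd≤+m⇒n≤m+downs*2 : ∀ {n m} (X : Path n) → hEnd X ℤ.≤ + m → n ≤ m + downs X * 2
hEnd≤+m⇒n≤m+downs*2 {m = m} X h≤m = ℤ.drop‿+≤+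
  (subst₂ ℤ._≤_ (hEnd+downs*2 X) (sym (ℤ.pos-+ m (downs X * 2))) (ℤ.+-monoˡ-≤ (+ (downs X * 2)) h≤m))

m+downs*2≡n⇒hEnd≡+m : ∀ {n m} (X : Path n) → m + downs X * 2 ≡ n → hEnd X ≡ + m
m+downs*2≡n⇒hEnd≡+m {m = m} X eq = +ℤ-cancelʳ (+ (downs X * 2)) _ _
  (trans (hEnd+downs*2 X) (trans (cong +_ (sym eq)) (ℤ.pos-+ m (downs X * 2))))

ht-zero : ∀ {n} (X : Path n) → ht Fin.zero X ≡ + 0
ht-zero []      = refl
ht-zero (_ ∷ _) = refl

ht-suc : ∀ {n} (a : Fin (suc n)) b (X : Path n) → ht (Fin.suc a) (b ∷ X) ≡ stepVal b ℤ.+ ht a X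
ht-suc a b X = lookup-map a (λ h → stepVal b ℤ.+ h) (heights X)

ht-negP : ∀ {n} (a : Fin (suc n)) (X : Path n) → ht a (negP X) ≡ ℤ.- ht a X
ht-negP Fin.zero    X       = trans (ht-zero (negP X)) (cong ℤ.-_ (sym (ht-zero X)))
ht-negP (Fin.suc a) (b ∷ X) = begin
  ht (Fin.suc a) (negP (b ∷ X))            ≡⟨ ht-suc a (not b) (negP X) ⟩
  stepVal (not b) ℤ.+ ht a (negP X)        ≡⟨ cong₂ ℤ._+_ (stepVal-not b) (ht-negP a X) ⟩
  ℤ.- stepVal b ℤ.+ ℤ.- ht a X             ≡⟨ ℤ.neg-distrib-+ (stepVal b) (ht a X) ⟨
  ℤ.- (stepVal b ℤ.+ ht a X)               ≡⟨ cong ℤ.-_ (ht-suc a b X) ⟨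
  ℤ.- ht (Fin.suc a) (b ∷ X)               ∎
  where
  open ≡-Reasoning
  stepVal-not : ∀ b → stepVal (not b) ≡ ℤ.- stepVal b
  stepVal-not true  = refl
  stepVal-not false = refl

negP-antitone : ∀ {n} (P Q : Path n) → Q ≤ₚ P → negP P ≤ₚ negP Q
negP-antitone P Q Q≤P a =
  subst₂ ℤ._≤_ (sym (ht-negP a P)) (sym (ht-negP a Q)) (ℤ.neg-mono-≤ (Q≤P a))

record _≼[_]_ {n} (Q : Path n) (c : ℤ) (P : Path n) : Set where
  constructor ≼-intro
  field ≼-at : ∀ a → ht a Q ℤ.≤ c ℤ.+ ht a P
open _≼[_]_

≼-tail : ∀ {n} {c x y} {X Y : Path n} → (y ∷ Y) ≼[ c ] (x ∷ X) →
         Y ≼[ (stepVal x ℤ.- stepVal y) ℤ.+ c ] X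
≼-tail {c = c} {x} {y} {X} {Y} h = ≼-intro λ a → begin
  ht a Y                                   ≡⟨ cancel (stepVal y) (ht a Y) ⟩
  ℤ.- stepVal y ℤ.+ (stepVal y ℤ.+ ht a Y) ≡⟨ cong (λ h → ℤ.- stepVal y ℤ.+ h) (ht-suc a y Y) ⟨
  ℤ.- stepVal y ℤ.+ ht (Fin.suc a) (y ∷ Y) ≤⟨ ℤ.+-monoʳ-≤ (ℤ.- stepVal y) (≼-at h (Fin.suc a)) ⟩
  ℤ.- stepVal y ℤ.+ (c ℤ.+ ht (Fin.suc a) (x ∷ X))
    ≡⟨ cong (λ w → ℤ.- stepVal y ℤ.+ (c ℤ.+ w)) (ht-suc a x X) ⟩
  ℤ.- stepVal y ℤ.+ (c ℤ.+ (stepVal x ℤ.+ ht a X)) ≡⟨ regroup (stepVal x) (stepVal y) c (ht a X) ⟩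
  (stepVal x ℤ.- stepVal y) ℤ.+ c ℤ.+ ht a X ∎
  where
  open ℤ.≤-Reasoning
  cancel : ∀ s h → h ≡ ℤ.- s ℤ.+ (s ℤ.+ h)
  cancel = ℤ-Solver.solve-∀
  regroup : ∀ s t c h → ℤ.- t ℤ.+ (c ℤ.+ (s ℤ.+ h)) ≡ (s ℤ.- t) ℤ.+ c ℤ.+ h
  regroup = ℤ-Solver.solve-∀

≼-∷ : ∀ {n} {c x y} {X Y : Path n} → + 0 ℤ.≤ c →
      Y ≼[ (stepVal x ℤ.- stepVal y) ℤ.+ c ] X → (y ∷ Y) ≼[ c ] (x ∷ X)
≼-∷ {c = c} {x} {y} {X} {Y} c≥0 h = ≼-intro at
  where
  open ℤ.≤-Reasoning
  regroup : ∀ s t c h → t ℤ.+ ((s ℤ.- t) ℤ.+ c ℤ.+ h) ≡ c ℤ.+ (s ℤ.+ h)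
  regroup = ℤ-Solver.solve-∀
  at : ∀ a → ht a (y ∷ Y) ℤ.≤ c ℤ.+ ht a (x ∷ X)
  at Fin.zero    = subst (λ w → + 0 ℤ.≤ w) (sym (ℤ.+-identityʳ c)) c≥0
  at (Fin.suc a) = begin
    ht (Fin.suc a) (y ∷ Y)                                     ≡⟨ ht-suc a y Y ⟩
    stepVal y ℤ.+ ht a Y                                       ≤⟨ ℤ.+-monoʳ-≤ (stepVal y) (≼-at h a) ⟩
    stepVal y ℤ.+ ((stepVal x ℤ.- stepVal y) ℤ.+ c ℤ.+ ht a X) ≡⟨ regroup (stepVal x) (stepVal y) c (ht a X) ⟩
    c ℤ.+ (stepVal x ℤ.+ ht a X)                               ≡⟨ cong (λ w → c ℤ.+ w) (ht-suc a x X) ⟨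
    c ℤ.+ ht (Fin.suc a) (x ∷ X)                               ∎

-- The disagreement path (P - Q)/2 read from a starting height s, k or j.
gapNonNegFrom : ∀ {n} → ℕ → Path n → Path n → Bool
gapNonNegFrom s       []          []          = true
gapNonNegFrom s       (true ∷ P)  (false ∷ Q) = gapNonNegFrom (suc s) P Q
gapNonNegFrom s       (true ∷ P)  (true ∷ Q)  = gapNonNegFrom s P Q
gapNonNegFrom s       (false ∷ P) (false ∷ Q) = gapNonNegFrom s P Q
gapNonNegFrom zero    (false ∷ P) (true ∷ Q)  = false
gapNonNegFrom (suc s) (false ∷ P) (true ∷ Q)  = gapNonNegFrom s P Q

gapHitsZeroFrom : ∀ {n} → ℕ → Path n → Path n → Bool
gapHitsZeroFrom zero    _           _           = true
gapHitsZeroFrom (suc j) []          []          = false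
gapHitsZeroFrom (suc j) (true ∷ P)  (false ∷ Q) = gapHitsZeroFrom (suc (suc j)) P Q
gapHitsZeroFrom (suc j) (false ∷ P) (true ∷ Q)  = gapHitsZeroFrom j P Q
gapHitsZeroFrom (suc j) (true ∷ P)  (true ∷ Q)  = gapHitsZeroFrom (suc j) P Q
gapHitsZeroFrom (suc j) (false ∷ P) (false ∷ Q) = gapHitsZeroFrom (suc j) P Q

-- Truncated at 0, which never happens where the path stays nonnegative.
gapEndFrom : ∀ {n} → ℕ → Path n → Path n → ℕ
gapEndFrom k []          []          = k
gapEndFrom k (true ∷ P)  (false ∷ Q) = gapEndFrom (suc k) P Q
gapEndFrom k (false ∷ P) (true ∷ Q)  = gapEndFrom (pred k) P Q
gapEndFrom k (true ∷ P)  (true ∷ Q)  = gapEndFrom k P Q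
gapEndFrom k (false ∷ P) (false ∷ Q) = gapEndFrom k P Q

≼⇒gapNonNegFrom : ∀ {n} s (P Q : Path n) → Q ≼[ + (s * 2) ] P → gapNonNegFrom s P Q ≡ true
≼⇒gapNonNegFrom s       []          []          h = refl
≼⇒gapNonNegFrom s       (true ∷ P)  (false ∷ Q) h = ≼⇒gapNonNegFrom (suc s) P Q (≼-tail h)
≼⇒gapNonNegFrom zero    (false ∷ P) (true ∷ Q)  h
  with () ← subst₂ ℤ._≤_ (ht-zero Q) (cong (λ w → -[1+ 1 ] ℤ.+ w) (ht-zero P)) (≼-at (≼-tail h) Fin.zero)
≼⇒gapNonNegFrom (suc s) (false ∷ P) (true ∷ Q)  h = ≼⇒gapNonNegFrom s P Q (≼-tail h)
≼⇒gapNonNegFrom s       (true ∷ P)  (true ∷ Q)  h = ≼⇒gapNonNegFrom s P Q (≼-tail h)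
≼⇒gapNonNegFrom s       (false ∷ P) (false ∷ Q) h = ≼⇒gapNonNegFrom s P Q (≼-tail h)

gapNonNegFrom⇒≼ : ∀ {n} s (P Q : Path n) → gapNonNegFrom s P Q ≡ true → Q ≼[ + (s * 2) ] P
gapNonNegFrom⇒≼ s       []          []          h = ≼-intro λ { Fin.zero → +≤+ z≤n }
gapNonNegFrom⇒≼ s       (true ∷ P)  (false ∷ Q) h = ≼-∷ (+≤+ z≤n) (gapNonNegFrom⇒≼ (suc s) P Q h)
gapNonNegFrom⇒≼ (suc s) (false ∷ P) (true ∷ Q)  h = ≼-∷ (+≤+ z≤n) (gapNonNegFrom⇒≼ s P Q h)
gapNonNegFrom⇒≼ s       (true ∷ P)  (true ∷ Q)  h = ≼-∷ (+≤+ z≤n) (gapNonNegFrom⇒≼ s P Q h)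
gapNonNegFrom⇒≼ s       (false ∷ P) (false ∷ Q) h = ≼-∷ (+≤+ z≤n) (gapNonNegFrom⇒≼ s P Q h)

≤ₚ⇒gapNonNeg : ∀ {n} (P Q : Path n) → Q ≤ₚ P → gapNonNegFrom 0 P Q ≡ true
≤ₚ⇒gapNonNeg P Q Q≤P = ≼⇒gapNonNegFrom 0 P Q (≼-intro λ a →
  subst (λ w → ht a Q ℤ.≤ w) (sym (ℤ.+-identityˡ (ht a P))) (Q≤P a))

gapNonNeg⇒≤ₚ : ∀ {n} (P Q : Path n) → gapNonNegFrom 0 P Q ≡ true → Q ≤ₚ P
gapNonNeg⇒≤ₚ P Q h a =
  subst (λ w → ht a Q ℤ.≤ w) (ℤ.+-identityˡ (ht a P)) (≼-at (gapNonNegFrom⇒≼ 0 P Q h) a)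

gapHitsZero⇒≤ : ∀ {n} s j (P Q : Path n) →
  gapNonNegFrom s P Q ≡ true → gapHitsZeroFrom j P Q ≡ true → j ≤ s
gapHitsZero⇒≤ s       zero    P           Q           _ _ = z≤n
gapHitsZero⇒≤ s       (suc j) []          []          h ()
gapHitsZero⇒≤ s       (suc j) (true ∷ P)  (false ∷ Q) h r = ℕ.≤-pred (gapHitsZero⇒≤ (suc s) (suc (suc j)) P Q h r)
gapHitsZero⇒≤ s       (suc j) (true ∷ P)  (true ∷ Q)  h r = gapHitsZero⇒≤ s (suc j) P Q h r
gapHitsZero⇒≤ s       (suc j) (false ∷ P) (false ∷ Q) h r = gapHitsZero⇒≤ s (suc j) P Q h r
gapHitsZero⇒≤ (suc s) (suc j) (false ∷ P) (true ∷ Q)  h r = s≤s (gapHitsZero⇒≤ s j P Q h r)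

gapHitsZero-suc : ∀ {n} s (P Q : Path n) →
  gapNonNegFrom (suc s) P Q ≡ true → gapNonNegFrom s P Q ≡ false → gapHitsZeroFrom (suc s) P Q ≡ true
gapHitsZero-suc s       []          []          h ()
gapHitsZero-suc s       (true ∷ P)  (false ∷ Q) h ¬h = gapHitsZero-suc (suc s) P Q h ¬h
gapHitsZero-suc s       (true ∷ P)  (true ∷ Q)  h ¬h = gapHitsZero-suc s P Q h ¬h
gapHitsZero-suc s       (false ∷ P) (false ∷ Q) h ¬h = gapHitsZero-suc s P Q h ¬h
gapHitsZero-suc zero    (false ∷ P) (true ∷ Q)  h ¬h = refl
gapHitsZero-suc (suc s) (false ∷ P) (true ∷ Q)  h ¬h = gapHitsZero-suc s P Q h ¬h

gapEndFrom-suc : ∀ {n} k (P Q : Path n) →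
  gapNonNegFrom k P Q ≡ true → gapEndFrom (suc k) P Q ≡ suc (gapEndFrom k P Q)
gapEndFrom-suc k       []          []          h = refl
gapEndFrom-suc k       (true ∷ P)  (false ∷ Q) h = gapEndFrom-suc (suc k) P Q h
gapEndFrom-suc k       (true ∷ P)  (true ∷ Q)  h = gapEndFrom-suc k P Q h
gapEndFrom-suc k       (false ∷ P) (false ∷ Q) h = gapEndFrom-suc k P Q h
gapEndFrom-suc (suc k) (false ∷ P) (true ∷ Q)  h = gapEndFrom-suc k P Q h

gapEndFrom+downs : ∀ {n} k (P Q : Path n) →
  gapNonNegFrom k P Q ≡ true → gapEndFrom k P Q + downs P ≡ k + downs Q
gapEndFrom+downs k       []          []          h = refl
gapEndFrom+downs k       (true ∷ P)  (false ∷ Q) h =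
  trans (gapEndFrom+downs (suc k) P Q h) (sym (ℕ.+-suc k (downs Q)))
gapEndFrom+downs k       (true ∷ P)  (true ∷ Q)  h = gapEndFrom+downs k P Q h
gapEndFrom+downs k       (false ∷ P) (false ∷ Q) h =
  trans (ℕ.+-suc (gapEndFrom k P Q) (downs P))
        (trans (cong suc (gapEndFrom+downs k P Q h)) (sym (ℕ.+-suc k (downs Q))))
gapEndFrom+downs (suc k) (false ∷ P) (true ∷ Q)  h =
  trans (ℕ.+-suc (gapEndFrom k P Q) (downs P)) (cong suc (gapEndFrom+downs k P Q h))

-- A single path X is the disagreement path of the pair (X, -X).
nonNegFrom : ∀ {n} → ℕ → Path n → Bool
nonNegFrom s X = gapNonNegFrom s X (negP X)

hitsZeroFrom : ∀ {n} → ℕ → Path n → Bool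
hitsZeroFrom j X = gapHitsZeroFrom j X (negP X)

endFrom : ∀ {n} → ℕ → Path n → ℕ
endFrom k X = gapEndFrom k X (negP X)

NonNeg⇒nonNeg : ∀ {n} (X : Path n) → NonNeg X → nonNegFrom 0 X ≡ true
NonNeg⇒nonNeg X X≥0 = ≤ₚ⇒gapNonNeg X (negP X) λ a →
  subst (λ w → w ℤ.≤ ht a X) (sym (ht-negP a X)) (ℤ.≤-trans (ℤ.neg-mono-≤ (X≥0 a)) (X≥0 a))

nonNegFrom-suc : ∀ {n} s (X : Path n) → nonNegFrom s X ≡ true → nonNegFrom (suc s) X ≡ true
nonNegFrom-suc s       []          h = refl
nonNegFrom-suc s       (true ∷ X)  h = nonNegFrom-suc (suc s) X h
nonNegFrom-suc (suc s) (false ∷ X) h = nonNegFrom-suc s X h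

_⊑_ : ∀ {n} → Path n → Path n → Bool
[]          ⊑ []         = true
(true ∷ Y)  ⊑ (true ∷ X) = Y ⊑ X
(true ∷ Y)  ⊑ (false ∷ X) = false
(false ∷ Y) ⊑ (_ ∷ X)    = Y ⊑ X

raised : ∀ {n} → Path n → Path n → ℕ
raised []          []          = 0
raised (false ∷ Y) (true ∷ X)  = suc (raised Y X)
raised (false ∷ Y) (false ∷ X) = raised Y X
raised (true ∷ Y)  (_ ∷ X)     = raised Y X

nonNegFrom-⊑ : ∀ {n} s (Y X : Path n) → nonNegFrom s Y ≡ true → Y ⊑ X ≡ true → nonNegFrom s X ≡ true
nonNegFrom-⊑ s       []          []          h Y⊑X = refl
nonNegFrom-⊑ s       (true ∷ Y)  (true ∷ X)  h Y⊑X = nonNegFrom-⊑ (suc s) Y X h Y⊑X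
nonNegFrom-⊑ (suc s) (false ∷ Y) (true ∷ X)  h Y⊑X =
  nonNegFrom-suc (suc s) X (nonNegFrom-suc s X (nonNegFrom-⊑ s Y X h Y⊑X))
nonNegFrom-⊑ (suc s) (false ∷ Y) (false ∷ X) h Y⊑X = nonNegFrom-⊑ s Y X h Y⊑X

hitsZero-⊑ : ∀ {n} s j (Y X : Path n) →
  nonNegFrom s Y ≡ true → Y ⊑ X ≡ true → hitsZeroFrom j X ≡ true → j ≤ s
hitsZero-⊑ s j Y X Y≥0 Y⊑X = gapHitsZero⇒≤ s j X (negP X) (nonNegFrom-⊑ s Y X Y≥0 Y⊑X)

endFrom-pred : ∀ {n} m (X : Path n) → nonNegFrom 0 X ≡ true → suc m ≤ endFrom 1 X → m ≤ endFrom 0 X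
endFrom-pred m X X≥0 h = ℕ.≤-pred (subst (suc m ≤_) (gapEndFrom-suc 0 X (negP X) X≥0) h)

endFrom+downs*2 : ∀ {n} (X : Path n) → nonNegFrom 0 X ≡ true → endFrom 0 X + downs X * 2 ≡ n
endFrom+downs*2 X X≥0 = begin
  endFrom 0 X + downs X * 2         ≡⟨ m+n*2≡m+n+n (endFrom 0 X) (downs X) ⟩
  endFrom 0 X + downs X + downs X   ≡⟨ cong (_+ downs X) (gapEndFrom+downs 0 X (negP X) X≥0) ⟩
  downs (negP X) + downs X          ≡⟨ ℕ.+-comm (downs (negP X)) (downs X) ⟩
  downs X + downs (negP X)          ≡⟨ downs+downs-negP X ⟩
  _                                 ∎
  where open ≡-Reasoning

-- Turns the first K unmatched U steps of (X - Y)/2 into D steps.  Since (X - Y)/2 ≥ 0,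
-- a U step is unmatched exactly when the rest of the path stays at or above its top.
mutual
  restoreUnmatched : ∀ {n} → ℕ → Path n → Path n → Path n × Path n
  restoreUnmatched K       []          []          = [] , []
  restoreUnmatched zero    (x ∷ X)     (y ∷ Y)     = consBoth x y (restoreUnmatched zero X Y)
  restoreUnmatched (suc K) (true ∷ X)  (false ∷ Y) = restoreIf (gapNonNegFrom 0 X Y) K X Y
  restoreUnmatched (suc K) (true ∷ X)  (true ∷ Y)  = consBoth true true (restoreUnmatched (suc K) X Y)
  restoreUnmatched (suc K) (false ∷ X) (y ∷ Y)     = consBoth false y (restoreUnmatched (suc K) X Y)

  restoreIf : ∀ {n} → Bool → ℕ → Path n → Path n → Path (suc n) × Path (suc n)
  restoreIf true  K X Y = consBoth false true (restoreUnmatched K X Y)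
  restoreIf false K X Y = consBoth true false (restoreUnmatched (suc K) X Y)

  consBoth : ∀ {n} → Bool → Bool → Path n × Path n → Path (suc n) × Path (suc n)
  consBoth x y (P , Q) = x ∷ P , y ∷ Q

record RestoresUnmatched {n} (k K : ℕ) (X Y P Q₁ : Path n) : Set where
  field
    flipAt-P   : flipAt (unmatchedDFrom k P Q₁) P ≡ X
    flipAt-Q₁  : flipAt (unmatchedDFrom k P Q₁) Q₁ ≡ Y
    Y≤P        : gapNonNegFrom k P Y ≡ true
    Y⊑Q₁       : Y ⊑ Q₁ ≡ true
    raised-Y-Q₁ : raised Y Q₁ ≡ K
    downs-P    : downs P ≡ downs X + K
    downs-Q₁   : downs Q₁ + K ≡ downs Y
open RestoresUnmatched

unmatchedDFrom-DD : ∀ {n} k (P Q : Path n) →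
  unmatchedDFrom k (false ∷ P) (false ∷ Q) ≡ false ∷ unmatchedDFrom k P Q
unmatchedDFrom-DD zero    P Q = refl
unmatchedDFrom-DD (suc k) P Q = refl

module _ {n} {K : ℕ} {X Y P Q₁ : Path n} where

  ∷-UU : ∀ {k} → RestoresUnmatched k K X Y P Q₁ →
         RestoresUnmatched k K (true ∷ X) (true ∷ Y) (true ∷ P) (true ∷ Q₁)
  ∷-UU r = record
    { flipAt-P = cong (true ∷_) (flipAt-P r) ; flipAt-Q₁ = cong (true ∷_) (flipAt-Q₁ r)
    ; Y≤P = Y≤P r ; Y⊑Q₁ = Y⊑Q₁ r ; raised-Y-Q₁ = raised-Y-Q₁ r
    ; downs-P = downs-P r ; downs-Q₁ = downs-Q₁ r }

  ∷-DD : ∀ {k} → RestoresUnmatched k K X Y P Q₁ →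
         RestoresUnmatched k K (false ∷ X) (false ∷ Y) (false ∷ P) (false ∷ Q₁)
  ∷-DD {k} r = record
    { flipAt-P = trans (cong (λ χ → flipAt χ (false ∷ P)) (unmatchedDFrom-DD k P Q₁))
                       (cong (false ∷_) (flipAt-P r))
    ; flipAt-Q₁ = trans (cong (λ χ → flipAt χ (false ∷ Q₁)) (unmatchedDFrom-DD k P Q₁))
                        (cong (false ∷_) (flipAt-Q₁ r))
    ; Y≤P = Y≤P r ; Y⊑Q₁ = Y⊑Q₁ r ; raised-Y-Q₁ = raised-Y-Q₁ r
    ; downs-P = cong suc (downs-P r) ; downs-Q₁ = cong suc (downs-Q₁ r) }

  ∷-UD : ∀ {k} → RestoresUnmatched (suc k) K X Y P Q₁ →
         RestoresUnmatched k K (true ∷ X) (false ∷ Y) (true ∷ P) (false ∷ Q₁)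
  ∷-UD r = record
    { flipAt-P = cong (true ∷_) (flipAt-P r) ; flipAt-Q₁ = cong (false ∷_) (flipAt-Q₁ r)
    ; Y≤P = Y≤P r ; Y⊑Q₁ = Y⊑Q₁ r ; raised-Y-Q₁ = raised-Y-Q₁ r
    ; downs-P = downs-P r ; downs-Q₁ = cong suc (downs-Q₁ r) }

  ∷-DU : ∀ {k} → RestoresUnmatched k K X Y P Q₁ →
         RestoresUnmatched (suc k) K (false ∷ X) (true ∷ Y) (false ∷ P) (true ∷ Q₁)
  ∷-DU r = record
    { flipAt-P = cong (false ∷_) (flipAt-P r) ; flipAt-Q₁ = cong (true ∷_) (flipAt-Q₁ r)
    ; Y≤P = Y≤P r ; Y⊑Q₁ = Y⊑Q₁ r ; raised-Y-Q₁ = raised-Y-Q₁ r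
    ; downs-P = cong suc (downs-P r) ; downs-Q₁ = downs-Q₁ r }

  ∷-restore : RestoresUnmatched 0 K X Y P Q₁ →
              RestoresUnmatched 0 (suc K) (true ∷ X) (false ∷ Y) (false ∷ P) (true ∷ Q₁)
  ∷-restore r = record
    { flipAt-P = cong (true ∷_) (flipAt-P r) ; flipAt-Q₁ = cong (false ∷_) (flipAt-Q₁ r)
    ; Y≤P = Y≤P r ; Y⊑Q₁ = Y⊑Q₁ r ; raised-Y-Q₁ = cong suc (raised-Y-Q₁ r)
    ; downs-P = trans (cong suc (downs-P r)) (sym (ℕ.+-suc (downs X) K))
    ; downs-Q₁ = trans (ℕ.+-suc (downs Q₁) K) (cong suc (downs-Q₁ r)) }

-- k is the number of open U steps of (P - Q₁)/2; a restored step is an unmatched D step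
-- only when k = 0, whence the last hypothesis.
restoreUnmatched-spec : ∀ {n} K k (X Y : Path n) →
  gapNonNegFrom k X Y ≡ true → K ≤ gapEndFrom k X Y → K ≡ 0 ⊎ gapHitsZeroFrom k X Y ≡ true →
  uncurry (RestoresUnmatched k K X Y) (restoreUnmatched K X Y)
restoreUnmatched-spec zero    k       []          []          _ _ _ = record
  { flipAt-P = refl ; flipAt-Q₁ = refl ; Y≤P = refl ; Y⊑Q₁ = refl ; raised-Y-Q₁ = refl
  ; downs-P = refl ; downs-Q₁ = refl }
restoreUnmatched-spec (suc K) zero    []          []          _ () _
restoreUnmatched-spec (suc K) (suc k) []          []          _ _ (inj₂ ())
restoreUnmatched-spec zero    k       (true ∷ X)  (true ∷ Y)  h _ _ =
  ∷-UU (restoreUnmatched-spec 0 k X Y h z≤n (inj₁ refl))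
restoreUnmatched-spec zero    k       (true ∷ X)  (false ∷ Y) h _ _ =
  ∷-UD (restoreUnmatched-spec 0 (suc k) X Y h z≤n (inj₁ refl))
restoreUnmatched-spec zero    k       (false ∷ X) (false ∷ Y) h _ _ =
  ∷-DD (restoreUnmatched-spec 0 k X Y h z≤n (inj₁ refl))
restoreUnmatched-spec zero    (suc k) (false ∷ X) (true ∷ Y)  h _ _ =
  ∷-DU (restoreUnmatched-spec 0 k X Y h z≤n (inj₁ refl))
restoreUnmatched-spec (suc K) k       (_ ∷ _)     (_ ∷ _)     _ _ (inj₁ ())
restoreUnmatched-spec (suc K) zero    (true ∷ X)  (true ∷ Y)  h b _ =
  ∷-UU (restoreUnmatched-spec (suc K) 0 X Y h b (inj₂ refl))
restoreUnmatched-spec (suc K) (suc k) (true ∷ X)  (true ∷ Y)  h b r =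
  ∷-UU (restoreUnmatched-spec (suc K) (suc k) X Y h b r)
restoreUnmatched-spec (suc K) zero    (false ∷ X) (false ∷ Y) h b _ =
  ∷-DD (restoreUnmatched-spec (suc K) 0 X Y h b (inj₂ refl))
restoreUnmatched-spec (suc K) (suc k) (false ∷ X) (false ∷ Y) h b r =
  ∷-DD (restoreUnmatched-spec (suc K) (suc k) X Y h b r)
restoreUnmatched-spec (suc K) (suc k) (false ∷ X) (true ∷ Y)  h b r =
  ∷-DU (restoreUnmatched-spec (suc K) k X Y h b r)
restoreUnmatched-spec (suc K) zero    (true ∷ X)  (false ∷ Y) h b _ with gapNonNegFrom 0 X Y in e
... | true  = ∷-restore (restoreUnmatched-spec K 0 X Y e
                (ℕ.≤-pred (subst (suc K ≤_) (gapEndFrom-suc 0 X Y e) b)) (inj₂ refl))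
... | false = ∷-UD (restoreUnmatched-spec (suc K) 1 X Y h b (inj₂ (gapHitsZero-suc 0 X Y h e)))
restoreUnmatched-spec (suc K) (suc k) (true ∷ X)  (false ∷ Y) h b (inj₂ r) with gapNonNegFrom 0 X Y in e
... | true  with () ← gapHitsZero⇒≤ 0 (suc (suc k)) X Y e r
... | false = ∷-UD (restoreUnmatched-spec (suc K) (suc (suc k)) X Y h b (inj₂ r))

restoreUnmatched-correct : ∀ {n} K (X Y : Path n) → Y ≤ₚ X → downs X + K ≤ downs Y →
  uncurry (RestoresUnmatched 0 K X Y) (restoreUnmatched K X Y)
restoreUnmatched-correct K X Y Y≤X budget = restoreUnmatched-spec K 0 X Y gap≥0 K≤end (inj₂ refl)
  where
  gap≥0 = ≤ₚ⇒gapNonNeg X Y Y≤X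
  K≤end : K ≤ gapEndFrom 0 X Y
  K≤end = ℕ.+-cancelʳ-≤ (downs X) K _ (subst₂ _≤_ (ℕ.+-comm (downs X) K)
            (sym (gapEndFrom+downs 0 X Y gap≥0)) budget)

-- In the inverse of flipBelow, z is the current height of Q, and the rest of
-- Q₁ = flipBelow Q is read from height floorGap z: its height above the level where
-- Q would return to 0 (z ≥ 0), resp. to -1 (z < 0).
floorGap : ℤ → ℕ
floorGap (+ c)    = c
floorGap -[1+ c ] = c

belowBit : ℤ → ℕ
belowBit (+ _)    = 0
belowBit -[1+ _ ] = 1

belowDepth : ℤ → ℕ
belowDepth (+ _)    = 0
belowDepth -[1+ c ] = c

-- Q₁ has a last visit of the level relevant to z still ahead (needed when Q is below
-- 0 and must come back, or when there is budget M left to go below 0 again).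
ReturnAhead : ∀ {n} → ℤ → ℕ → Path n → Set
ReturnAhead (+ c)    M X = M ≡ 0 ⊎ hitsZeroFrom c X ≡ true
ReturnAhead -[1+ c ] M X = hitsZeroFrom c X ≡ true

-- At a U step after which Q₁ never comes back
-- (nonNegFrom 0 X), Q leaves 0 downwards while budget M remains, resp. returns to 0.
-- The clauses with a D step of Q₁ at floorGap z = 0 are never reached.
mutual
  unflipBelowFrom : ∀ {n} → ℕ → ℤ → Path n → Path n
  unflipBelowFrom M z             []          = []
  unflipBelowFrom M (+ zero)      (true ∷ X)  = leaveZero M (nonNegFrom 0 X) X
  unflipBelowFrom M (+ zero)      (false ∷ X) = false ∷ unflipBelowFrom M -[1+ 0 ] X
  unflipBelowFrom M (+ suc c)     (true ∷ X)  = true ∷ unflipBelowFrom M (+ suc (suc c)) X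
  unflipBelowFrom M (+ suc c)     (false ∷ X) = false ∷ unflipBelowFrom M (+ c) X
  unflipBelowFrom M -[1+ zero ]   (true ∷ X)  = returnToZero M (nonNegFrom 0 X) X
  unflipBelowFrom M -[1+ zero ]   (false ∷ X) = true ∷ unflipBelowFrom M (+ 0) X
  unflipBelowFrom M -[1+ suc c ]  (true ∷ X)  = false ∷ unflipBelowFrom M -[1+ suc (suc c) ] X
  unflipBelowFrom M -[1+ suc c ]  (false ∷ X) = true ∷ unflipBelowFrom M -[1+ c ] X

  leaveZero : ∀ {n} → ℕ → Bool → Path n → Path (suc n)
  leaveZero zero    _     X = true ∷ unflipBelowFrom zero (+ 1) X
  leaveZero (suc M) true  X = false ∷ unflipBelowFrom M -[1+ 0 ] X
  leaveZero (suc M) false X = true ∷ unflipBelowFrom (suc M) (+ 1) X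

  returnToZero : ∀ {n} → ℕ → Bool → Path n → Path (suc n)
  returnToZero M true  X = true ∷ unflipBelowFrom M (+ 0) X
  returnToZero M false X = false ∷ unflipBelowFrom M -[1+ 1 ] X

-- Y is at height ∣ z ∣ + g * 2 (g ≥ 0 measures how far Y is above |Q|), so the
-- paths (Y - Q)/2 and (Y + Q)/2 are at heights gapAbove g z and gapBelow g z.
yLevel : ℕ → ℤ → ℕ
yLevel g z = ℤ.∣ z ∣ + g * 2

gapAbove : ℕ → ℤ → ℕ
gapAbove g (+ _)    = g
gapAbove g -[1+ c ] = suc c + g

gapBelow : ℕ → ℤ → ℕ
gapBelow g (+ c)    = c + g
gapBelow g -[1+ _ ] = g

record UnflipsBelow {n} (M g : ℕ) (z : ℤ) (X Y Q : Path n) : Set where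
  constructor unflips
  field
    flipBelow-Q : flipBelowFrom z Q ≡ X
    downs-Q     : belowDepth z + downs Q ≡ downs X + M
    Q≤Y         : gapNonNegFrom (gapAbove g z) Y Q ≡ true
    -Y≤Q        : gapNonNegFrom (gapBelow g z) Q (negP Y) ≡ true
open UnflipsBelow

-- Written with the step first, so that the height computes for canonical z.
flipBelowFrom-∷ : ∀ {n} z q {Q X : Path n} → flipBelowFrom (stepVal q ℤ.+ z) Q ≡ X →
  flipBelowFrom z (q ∷ Q) ≡ (if isNeg (stepVal q ℤ.+ z) then not q else q) ∷ X
flipBelowFrom-∷ z q {Q} eq =
  trans (cong (λ w → (if isNeg w then not q else q) ∷ flipBelowFrom w Q) (ℤ.+-comm z (stepVal q)))
        (cong (_ ∷_) eq)

suc≰+0 : ∀ {c} → ¬ suc c ≤ c + 0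
suc≰+0 {c} le = ℕ.1+n≰n (subst (suc c ≤_) (ℕ.+-identityʳ c) le)

+-suc² : ∀ a b → a + suc (suc b) ≡ suc (suc (a + b))
+-suc² a b = trans (ℕ.+-suc a (suc b)) (cong suc (ℕ.+-suc a b))

-- Each raised step of Y ahead must be absorbed by the slack g or by an excursion of Q
-- below 0 still to come.
UnflipBelowSpec : ∀ {n} → ℕ → ℕ → ℤ → Path n → Path n → Set
UnflipBelowSpec M g z X Y =
  nonNegFrom (yLevel g z) Y ≡ true → Y ⊑ X ≡ true → nonNegFrom (floorGap z) X ≡ true →
  belowBit z + M * 2 ≤ endFrom (floorGap z) X → ReturnAhead z M X →
  raised Y X ≤ belowBit z + (M + g) →
  UnflipsBelow M g z X Y (unflipBelowFrom M z X)

mutual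
  unflipBelow-spec⁺ : ∀ {n} M g c (X Y : Path n) → UnflipBelowSpec M g (+ c) X Y
  unflipBelow-spec⁺ zero    g c       []          []          _ _ _ _ _ _ = unflips refl refl refl refl
  unflipBelow-spec⁺ (suc M) g c       []          []          _ _ _ _ (inj₁ ()) _
  unflipBelow-spec⁺ (suc M) g zero    []          []          _ _ _ () _ _
  unflipBelow-spec⁺ (suc M) g (suc c) []          []          _ _ _ _ (inj₂ ()) _
  unflipBelow-spec⁺ M       g c       (false ∷ X) (true ∷ Y)  _ () _ _ _ _
  unflipBelow-spec⁺ M       g zero    (false ∷ X) (false ∷ Y) _ _ () _ _ _
  unflipBelow-spec⁺ zero    g zero    (true ∷ X)  (true ∷ Y)  Y≥0 Y⊑X X≥0 budget _ few =
    let r = unflipBelow-spec⁺ 0 g 1 X Y Y≥0 Y⊑X X≥0 budget (inj₁ refl) few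
    in unflips (flipBelowFrom-∷ (+ 0) true (flipBelow-Q r)) (downs-Q r) (Q≤Y r) (-Y≤Q r)
  unflipBelow-spec⁺ zero    zero    zero (true ∷ X) (false ∷ Y) () _ _ _ _ _
  unflipBelow-spec⁺ zero    (suc g) zero (true ∷ X) (false ∷ Y) Y≥0 Y⊑X X≥0 budget _ few =
    let r = unflipBelow-spec⁺ 0 g 1 X Y Y≥0 Y⊑X X≥0 budget (inj₁ refl) (ℕ.≤-pred few)
    in unflips (flipBelowFrom-∷ (+ 0) true (flipBelow-Q r)) (downs-Q r) (Q≤Y r) (-Y≤Q r)
  unflipBelow-spec⁺ (suc M) g zero (true ∷ X) (true ∷ Y) Y≥0 Y⊑X X≥0 budget _ few with nonNegFrom 0 X in last
  ... | true  =
    let r = unflipBelow-spec⁻ M g 0 X Y Y≥0 Y⊑X last (endFrom-pred _ X last budget) refl few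
    in unflips (flipBelowFrom-∷ (+ 0) false (flipBelow-Q r))
               (trans (cong suc (downs-Q r)) (sym (ℕ.+-suc (downs X) M))) (Q≤Y r) (-Y≤Q r)
  ... | false =
    let r = unflipBelow-spec⁺ (suc M) g 1 X Y Y≥0 Y⊑X X≥0 budget
              (inj₂ (gapHitsZero-suc 0 X (negP X) X≥0 last)) few
    in unflips (flipBelowFrom-∷ (+ 0) true (flipBelow-Q r)) (downs-Q r) (Q≤Y r) (-Y≤Q r)
  unflipBelow-spec⁺ (suc M) zero    zero (true ∷ X) (false ∷ Y) () _ _ _ _ _
  unflipBelow-spec⁺ (suc M) (suc g) zero (true ∷ X) (false ∷ Y) Y≥0 Y⊑X X≥0 budget _ few
    with nonNegFrom 0 X in last
  ... | true  =
    let r = unflipBelow-spec⁻ M g 0 X Y Y≥0 Y⊑X last (endFrom-pred _ X last budget) refl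
              (subst (raised Y X ≤_) (ℕ.+-suc M g) (ℕ.≤-pred few))
    in unflips (flipBelowFrom-∷ (+ 0) false (flipBelow-Q r))
               (trans (cong suc (downs-Q r)) (sym (ℕ.+-suc (downs X) M))) (Q≤Y r) (-Y≤Q r)
  ... | false =
    let r = unflipBelow-spec⁺ (suc M) g 1 X Y Y≥0 Y⊑X X≥0 budget
              (inj₂ (gapHitsZero-suc 0 X (negP X) X≥0 last)) (subst (raised Y X ≤_) (ℕ.+-suc M g) (ℕ.≤-pred few))
    in unflips (flipBelowFrom-∷ (+ 0) true (flipBelow-Q r)) (downs-Q r) (Q≤Y r) (-Y≤Q r)
  unflipBelow-spec⁺ M g (suc c) (true ∷ X) (true ∷ Y) Y≥0 Y⊑X X≥0 budget ahead few =
    let r = unflipBelow-spec⁺ M g (suc (suc c)) X Y Y≥0 Y⊑X X≥0 budget ahead few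
    in unflips (flipBelowFrom-∷ (+ suc c) true (flipBelow-Q r)) (downs-Q r) (Q≤Y r) (-Y≤Q r)
  unflipBelow-spec⁺ M (suc g) (suc c) (true ∷ X) (false ∷ Y) Y≥0 Y⊑X X≥0 budget ahead few =
    let r = unflipBelow-spec⁺ M g (suc (suc c)) X Y
              (subst (λ s → nonNegFrom s Y ≡ true) (+-suc² c (g * 2)) Y≥0) Y⊑X X≥0 budget ahead
              (ℕ.≤-pred (subst (suc (raised Y X) ≤_) (ℕ.+-suc M g) few))
    in unflips (flipBelowFrom-∷ (+ suc c) true (flipBelow-Q r)) (downs-Q r) (Q≤Y r)
               (subst (λ s → gapNonNegFrom s (unflipBelowFrom M (+ suc (suc c)) X) (negP Y) ≡ true)
                      (sym (cong suc (ℕ.+-suc c g))) (-Y≤Q r))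
  unflipBelow-spec⁺ zero zero (suc c) (true ∷ X) (false ∷ Y) _ _ _ _ (inj₁ refl) ()
  unflipBelow-spec⁺ M zero (suc c) (true ∷ X) (false ∷ Y) Y≥0 Y⊑X _ _ (inj₂ ahead) _ =
    ⊥-elim (suc≰+0 (ℕ.≤-trans (ℕ.n≤1+n (suc c)) (hitsZero-⊑ (c + 0) _ Y X Y≥0 Y⊑X ahead)))
  unflipBelow-spec⁺ M g (suc c) (false ∷ X) (false ∷ Y) Y≥0 Y⊑X X≥0 budget ahead few =
    let r = unflipBelow-spec⁺ M g c X Y Y≥0 Y⊑X X≥0 budget ahead few
    in unflips (flipBelowFrom-∷ (+ suc c) false (flipBelow-Q r)) (cong suc (downs-Q r)) (Q≤Y r) (-Y≤Q r)

  unflipBelow-spec⁻ : ∀ {n} M g c (X Y : Path n) → UnflipBelowSpec M g -[1+ c ] X Y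
  unflipBelow-spec⁻ M g zero    []          []          _ _ _ () _ _
  unflipBelow-spec⁻ M g (suc c) []          []          _ _ _ _ () _
  unflipBelow-spec⁻ M g c       (false ∷ X) (true ∷ Y)  _ () _ _ _ _
  unflipBelow-spec⁻ M g zero    (false ∷ X) (false ∷ Y) _ _ () _ _ _
  unflipBelow-spec⁻ M g zero    (true ∷ X)  (true ∷ Y)  Y≥0 Y⊑X X≥0 budget _ few with nonNegFrom 0 X in last
  ... | true  =
    let r = unflipBelow-spec⁺ M (suc g) 0 X Y Y≥0 Y⊑X last (endFrom-pred _ X last budget) (inj₂ refl)
              (subst (raised Y X ≤_) (sym (ℕ.+-suc M g)) few)
    in unflips (flipBelowFrom-∷ -[1+ 0 ] true (flipBelow-Q r)) (downs-Q r) (Q≤Y r) (-Y≤Q r)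
  ... | false =
    let r = unflipBelow-spec⁻ M g 1 X Y Y≥0 Y⊑X X≥0 budget (gapHitsZero-suc 0 X (negP X) X≥0 last) few
    in unflips (flipBelowFrom-∷ -[1+ 0 ] false (flipBelow-Q r)) (downs-Q r) (Q≤Y r) (-Y≤Q r)
  unflipBelow-spec⁻ M g zero    (true ∷ X)  (false ∷ Y) Y≥0 Y⊑X X≥0 budget _ few with nonNegFrom 0 X in last
  ... | true  =
    let r = unflipBelow-spec⁺ M g 0 X Y Y≥0 Y⊑X last (endFrom-pred _ X last budget) (inj₂ refl) (ℕ.≤-pred few)
    in unflips (flipBelowFrom-∷ -[1+ 0 ] true (flipBelow-Q r)) (downs-Q r) (Q≤Y r) (-Y≤Q r)
  unflipBelow-spec⁻ M zero    zero (true ∷ X) (false ∷ Y) Y≥0 Y⊑X X≥0 _ _ _ | false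
    with () ← hitsZero-⊑ 0 1 Y X Y≥0 Y⊑X (gapHitsZero-suc 0 X (negP X) X≥0 last)
  unflipBelow-spec⁻ M (suc g) zero (true ∷ X) (false ∷ Y) Y≥0 Y⊑X X≥0 budget _ few | false =
    let r = unflipBelow-spec⁻ M g 1 X Y Y≥0 Y⊑X X≥0 budget (gapHitsZero-suc 0 X (negP X) X≥0 last)
              (subst (raised Y X ≤_) (ℕ.+-suc M g) (ℕ.≤-pred few))
    in unflips (flipBelowFrom-∷ -[1+ 0 ] false (flipBelow-Q r)) (downs-Q r) (Q≤Y r) (-Y≤Q r)
  unflipBelow-spec⁻ M g (suc c) (true ∷ X) (true ∷ Y) Y≥0 Y⊑X X≥0 budget ahead few =
    let r = unflipBelow-spec⁻ M g (suc (suc c)) X Y Y≥0 Y⊑X X≥0 budget ahead few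
    in unflips (flipBelowFrom-∷ -[1+ suc c ] false (flipBelow-Q r))
               (trans (cong suc (ℕ.+-suc c _)) (downs-Q r)) (Q≤Y r) (-Y≤Q r)
  unflipBelow-spec⁻ M zero (suc c) (true ∷ X) (false ∷ Y) Y≥0 Y⊑X _ _ ahead _
    with s≤s le ← hitsZero-⊑ (suc c + 0) (suc (suc c)) Y X Y≥0 Y⊑X ahead = ⊥-elim (suc≰+0 le)
  unflipBelow-spec⁻ M (suc g) (suc c) (true ∷ X) (false ∷ Y) Y≥0 Y⊑X X≥0 budget ahead few =
    let r = unflipBelow-spec⁻ M g (suc (suc c)) X Y
              (subst (λ s → nonNegFrom s Y ≡ true) (cong suc (+-suc² c (g * 2))) Y≥0) Y⊑X X≥0 budget ahead
              (subst (raised Y X ≤_) (ℕ.+-suc M g) (ℕ.≤-pred few))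
    in unflips (flipBelowFrom-∷ -[1+ suc c ] false (flipBelow-Q r))
               (trans (cong suc (ℕ.+-suc c _)) (downs-Q r))
               (subst (λ s → gapNonNegFrom s Y (unflipBelowFrom M -[1+ suc (suc c) ] X) ≡ true)
                      (sym (cong suc (ℕ.+-suc (suc c) g))) (Q≤Y r))
               (-Y≤Q r)
  unflipBelow-spec⁻ M g (suc c) (false ∷ X) (false ∷ Y) Y≥0 Y⊑X X≥0 budget ahead few =
    let r = unflipBelow-spec⁻ M g c X Y Y≥0 Y⊑X X≥0 budget ahead few
    in unflips (flipBelowFrom-∷ -[1+ suc c ] true (flipBelow-Q r)) (cong suc (downs-Q r)) (Q≤Y r) (-Y≤Q r)

unflipBelow-correct : ∀ {n} M (Q₁ Y : Path n) → NonNeg Y → Y ⊑ Q₁ ≡ true →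
  M * 2 ≤ endFrom 0 Q₁ → raised Y Q₁ ≤ M → UnflipsBelow M 0 (+ 0) Q₁ Y (unflipBelowFrom M (+ 0) Q₁)
unflipBelow-correct M Q₁ Y Y≥0 Y⊑Q₁ budget few =
  unflipBelow-spec⁺ M 0 0 Q₁ Y y≥0 Y⊑Q₁ (nonNegFrom-⊑ 0 Y Q₁ y≥0 Y⊑Q₁) budget (inj₂ refl)
    (subst (raised Y Q₁ ≤_) (sym (ℕ.+-identityʳ M)) few)
  where y≥0 = NonNeg⇒nonNeg Y Y≥0

+*2-merge : ∀ a b k → a + b * 2 + k * 2 ≡ a + (b + k) * 2
+*2-merge = ℕ-Solver.solve-∀

even-difference : ∀ {a b} → a ≤ b → a % 2 ≡ b % 2 → ∃ λ k → a + k * 2 ≡ b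
even-difference {a} {b} a≤b a≡b = b / 2 ∸ a / 2 , (begin
  a + (b / 2 ∸ a / 2) * 2                 ≡⟨ cong (_+ (b / 2 ∸ a / 2) * 2) (m≡m%n+[m/n]*n a 2) ⟩
  a % 2 + a / 2 * 2 + (b / 2 ∸ a / 2) * 2 ≡⟨ ℕ.+-assoc (a % 2) _ _ ⟩
  a % 2 + (a / 2 * 2 + (b / 2 ∸ a / 2) * 2) ≡⟨ cong (λ w → a % 2 + w) (ℕ.*-distribʳ-+ 2 (a / 2) _) ⟨
  a % 2 + (a / 2 + (b / 2 ∸ a / 2)) * 2   ≡⟨ cong₂ (λ r q → r + q * 2) a≡b (ℕ.m+[n∸m]≡n (/-monoˡ-≤ 2 a≤b)) ⟩
  b % 2 + b / 2 * 2                       ≡⟨ m≡m%n+[m/n]*n b 2 ⟨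
  b                                       ∎)
  where open ≡-Reasoning

even-excess : ∀ {n} m (X : Path n) → + m ℤ.≤ hEnd X → m % 2 ≡ n % 2 →
  ∃ λ k → m + downs X * 2 + k * 2 ≡ n
even-excess m X m≤h m≡n =
  even-difference (+m≤hEnd⇒m+downs*2≤n X m≤h) (trans ([m+kn]%n≡m%n m (downs X) 2) m≡n)

hEnd-via-excess : ∀ {n m k} (Z X : Path n) → downs Z ≡ downs X + k → m + downs X * 2 + k * 2 ≡ n →
  hEnd Z ≡ + m
hEnd-via-excess {m = m} {k} Z X Z≡ X≡ = m+downs*2≡n⇒hEnd≡+m Z
  (trans (cong (λ d → m + d * 2) Z≡) (trans (sym (+*2-merge m (downs X) k)) X≡))

excess-≤ : ∀ {n a b c} k → a + b * 2 + k * 2 ≡ n → n ≤ a + c * 2 → b + k ≤ c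
excess-≤ {a = a} {b} {c} k eq n≤ =
  ℕ.*-cancelʳ-≤ (b + k) c 2
    (ℕ.+-cancelˡ-≤ a _ _ (subst (_≤ a + c * 2) (trans (sym eq) (+*2-merge a b k)) n≤))

unflip-budget : ∀ {n a d d₁ e} r k → a + d * 2 + r * 2 ≡ n → d₁ + k ≡ d → e + d₁ * 2 ≡ n → (r + k) * 2 ≤ e
unflip-budget {n} {a} {d} {d₁} {e} r k eq d≡ e≡ =
  subst ((r + k) * 2 ≤_) (ℕ.+-cancelʳ-≡ (d₁ * 2) (a + (r + k) * 2) e (trans regroup (sym e≡)))
        (ℕ.m≤n+m ((r + k) * 2) a)
  where
  open ≡-Reasoning
  shuffle : ∀ a r k d₁ → a + (r + k) * 2 + d₁ * 2 ≡ a + (d₁ + k) * 2 + r * 2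
  shuffle = ℕ-Solver.solve-∀
  regroup : a + (r + k) * 2 + d₁ * 2 ≡ n
  regroup = begin
    a + (r + k) * 2 + d₁ * 2   ≡⟨ shuffle a r k d₁ ⟩
    a + (d₁ + k) * 2 + r * 2   ≡⟨ cong (λ x → a + x * 2 + r * 2) d≡ ⟩
    a + d * 2 + r * 2          ≡⟨ eq ⟩
    n                          ∎

+i-+j≡+[i∸j] : ∀ {i j} → j ≤ i → + i ℤ.- + j ≡ + (i ∸ j)
+i-+j≡+[i∸j] {i} {j} j≤i = trans (ℤ.m-n≡m⊖n i j) (ℤ.⊖-≥ j≤i)

[i∸j]%2≡[i+j]%2 : ∀ {i j} → j ≤ i → (i ∸ j) % 2 ≡ (i + j) % 2
[i∸j]%2≡[i+j]%2 {i} {j} j≤i = begin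
  (i ∸ j) % 2             ≡⟨ [m+kn]%n≡m%n (i ∸ j) j 2 ⟨
  (i ∸ j + j * 2) % 2
    ≡⟨ cong (_% 2) (trans (m+n*2≡m+n+n (i ∸ j) j) (cong (_+ j) (ℕ.m∸n+n≡m j≤i))) ⟩
  (i + j) % 2             ∎
  where open ≡-Reasoning

lemma5p4 : (n i j : ℕ) → j ≤ i → i + j ≤ n → (i + j) % 2 ≡ n % 2 →
    (P' Q' : Path n) → InP n i j P' Q' →
    Σ (Path n) (λ P → Σ (Path n) (λ Q → InM n i j P Q × φ P Q ≡ (P' , Q')))
-- The hypothesis i + j ≤ n is implied by i + j ≤ h(P').
lemma5p4 n i j j≤i _ i+j≡n X Y (Y≥0 , Y≤X , i-j≤hY , hY≤i+j , i+j≤hX)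
  with even-excess (i + j) X i+j≤hX i+j≡n
     | even-excess (i ∸ j) Y (subst (ℤ._≤ hEnd Y) (+i-+j≡+[i∸j] j≤i) i-j≤hY)
                             (trans ([i∸j]%2≡[i+j]%2 j≤i) i+j≡n)
... | K , hX≡ | r , hY≡ = P , Q , (-P≤Q , Q≤P , hEnd-P , hEnd-Q) , φ≡
  where
  restored = restoreUnmatched-correct K X Y Y≤X (excess-≤ K hX≡ (hEnd≤+m⇒n≤m+downs*2 Y hY≤i+j))
  P  = proj₁ (restoreUnmatched K X Y)
  Q₁ = proj₂ (restoreUnmatched K X Y)
  Q₁≥0 = nonNegFrom-⊑ 0 Y Q₁ (NonNeg⇒nonNeg Y Y≥0) (Y⊑Q₁ restored)
  unflipped = unflipBelow-correct (r + K) Q₁ Y Y≥0 (Y⊑Q₁ restored)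
    (unflip-budget r K hY≡ (downs-Q₁ restored) (endFrom+downs*2 Q₁ Q₁≥0))
    (subst (_≤ r + K) (sym (raised-Y-Q₁ restored)) (ℕ.m≤n+m K r))
  Q = unflipBelowFrom (r + K) (+ 0) Q₁
  Y≤ₚP = gapNonNeg⇒≤ₚ P Y (Y≤P restored)
  -P≤Q : negP P ≤ₚ Q
  -P≤Q a = ℤ.≤-trans (negP-antitone P Y Y≤ₚP a) (gapNonNeg⇒≤ₚ Q (negP Y) (-Y≤Q unflipped) a)
  Q≤P : Q ≤ₚ P
  Q≤P a = ℤ.≤-trans (gapNonNeg⇒≤ₚ Y Q (Q≤Y unflipped) a) (Y≤ₚP a)
  downs-Q≡ : downs Q ≡ downs Y + r
  downs-Q≡ = trans (downs-Q unflipped) (trans (x∙yz≈xz∙y (downs Q₁) r K) (cong (_+ r) (downs-Q₁ restored)))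
  hEnd-P : hEnd P ≡ + (i + j)
  hEnd-P = hEnd-via-excess P X (downs-P restored) hX≡
  hEnd-Q : hEnd Q ≡ + i ℤ.- + j
  hEnd-Q = trans (hEnd-via-excess Q Y downs-Q≡ hY≡) (sym (+i-+j≡+[i∸j] j≤i))
  φ≡ : φ P Q ≡ (X , Y)
  φ≡ = trans (cong (λ W → flipAt (unmatchedD P W) P , flipAt (unmatchedD P W) W) (flipBelow-Q unflipped))
             (cong₂ _,_ (flipAt-P restored) (flipAt-Q₁ restored))
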